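{- Let $\mathcal{S}=(\mathcal{S}_1,\dots,\mathcal{S}_\ell)$ be a move sequence, $C=(c_1,\dots,c_t)$ a dependent cycle of $\mathcal{S}$ with cancellation vector $b$. Then for any $\tau_0\in\{\pm1\}^{V(\mathcal{S})}$ and any $\gamma_0\in\{\pm1\}^n$ extending $\tau_0$, the vector $w[C]=\sum_{j\in[t]}b_j\,\mathrm{imprv}_{\gamma_0,\mathcal{S}}(c_j)\in\mathbb{Z}^{E_n}$ satisfies $w[C]_e=\big(\sum_{j\in[t]}b_j\,\mathrm{imprv}_{\tau_0,\mathcal{S}}(c_j)\big)_e$ for every $e\in E(\mathcal{S})$ and $w[C]_e=0$ for every $e\in E_n\setminus E(\mathcal{S})$.
   Context: $V_n=[n]$, $K_n=(V_n,E_n)$ complete graph. A move sequence is $\mathcal{S}=(\mathcal{S}_1,\dots,\mathcal{S}_\ell)$, each $\mathcal{S}_i\subseteq V_n$ of size 1 or 2; $V(\mathcal{S})$ is the set of nodes occurring in it, $E(\mathcal{S})$ the edges with both endpoints in $V(\mathcal{S})$. Given $\gamma_0\in\{\pm1\}^n$ (resp. $\tau_0\in\{\pm1\}^{V(\mathcal{S})}$), $\gamma_i$ (resp. $\tau_i$) is obtained from $\gamma_{i-1}$ (resp. $\tau_{i-1}$) by flipping the nodes of $\mathcal{S}_i$. $\mathrm{imprv}_{\gamma_0,\mathcal{S}}(i)\in\{0,\pm1\}^{E_n}$: if $\mathcal{S}_i=\{u\}$, its entry at $\{u,w\}$ is $\gamma_{i-1}(u)\gamma_{i-1}(w)$, other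 entries 0; if $\mathcal{S}_i=\{u,v\}$, entry at $\{u,w\}$ ($w\notin\{u,v\}$) is $\gamma_{i-1}(u)\gamma_{i-1}(w)$, at $\{v,w\}$ ($w\notin\{u,v\}$) is $\gamma_{i-1}(v)\gamma_{i-1}(w)$, others 0. $\mathrm{imprv}_{\tau_0,\mathcal{S}}(i)$ is its restriction to $E(\mathcal{S})$ for any extension $\gamma_0$ of $\tau_0$. A cycle is a tuple $C=(c_1,\dots,c_t)$, $t\ge2$, of distinct indices with $\mathcal{S}_{c_j}=\{u_j,u_{j+1}\}$ ($j\in[t-1]$) and $\mathcal{S}_{c_t}=\{u_t,u_1\}$. It is dependent if there is $b\in\{\pm1\}^t$ with $b_j\tau_{c_j}(u_{j+1})+b_{j+1}\tau_{c_{j+1}}(u_{j+1})=0$ for $j\in[t-1]$ and $b_t\tau_{c_t}(u_1)+b_1\tau_{c_1}(u_1)=0$ (this property and $b$ do not depend on $\tau_0$); the unique such $b$ with $b_1=1$ is the cancellation vector. -}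

module Defs where

open import Data.Nat as ℕ using (ℕ; zero; suc)
open import Data.Fin as Fin using (Fin; toℕ; lower₁)
open import Data.Fin.Properties using () renaming (_≟_ to _≟ᶠ_)
open import Data.Bool using (Bool; true; false; if_then_else_; _∧_; _∨_; not)
open import Data.List using (List; []; _∷_; length; lookup; take)
open import Data.List.Relation.Unary.Any using (Any)
open import Data.Sign as Sg using (Sign; opposite)
open import Data.Integer as ℤ using (ℤ; _◃_; 0ℤ)
open import Data.Product using (_×_; Σ)
open import Data.Sum using (_⊎_)
open import Data.Empty using (⊥)
open import Relation.Binary.PropositionalEquality using (_≡_; _≢_; refl; sym)
open import Relation.Nullary using (yes; no; ¬_)
open import Relation.Nullary.Decidable using (⌊_⌋)

-- Nodes of K_n are Fin n.  Spins {±1} are Data.Sign.Sign.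
-- A move is a subset of V_n of size 1 or 2.

data Move (n : ℕ) : Set where
  single : Fin n → Move n
  pair   : (u v : Fin n) → u ≢ v → Move n

-- A move sequence S = (S_1,...,S_ℓ) is a list; S_i (1-indexed in the paper)
-- is  lookup S i  with 0-indexed i : Fin (length S).
MoveSeq : ℕ → Set
MoveSeq n = List (Move n)

_∈ᵇ_ : ∀ {n} → Fin n → Move n → Bool
x ∈ᵇ single u   = ⌊ x ≟ᶠ u ⌋
x ∈ᵇ pair u v _ = ⌊ x ≟ᶠ u ⌋ ∨ ⌊ x ≟ᶠ v ⌋

_∈V_ : ∀ {n} → Fin n → MoveSeq n → Set
x ∈V S = Any (λ m → (x ∈ᵇ m) ≡ true) S

-- E_n: edges {x,y} with x ≢ y (edge-indexed vectors are functions of the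
-- two endpoints; all our vectors are symmetric in x,y).
-- E(S): edges with both endpoints in V(S).
InES : ∀ {n} → MoveSeq n → Fin n → Fin n → Set
InES S x y = (x ≢ y) × (x ∈V S) × (y ∈V S)

sgn : Sign → ℤ
sgn s = s ◃ 1

Config : ℕ → Set
Config n = Fin n → Sign

flipMove : ∀ {n} → Move n → Config n → Config n
flipMove m γ x = if x ∈ᵇ m then opposite (γ x) else γ x

applyAll : ∀ {n} → List (Move n) → Config n → Config n
applyAll []       γ = γ
applyAll (m ∷ ms) γ = applyAll ms (flipMove m γ)

stateγ : ∀ {n} → MoveSeq n → Config n → ℕ → Config n
stateγ S γ₀ k = applyAll (take k S) γ₀

PConfig : ∀ {n} → MoveSeq n → Set
PConfig {n} S = (x : Fin n) → x ∈V S → Sign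

flipMoveτ : ∀ {n} {S : MoveSeq n} → Move n → PConfig S → PConfig S
flipMoveτ m τ x p = if x ∈ᵇ m then opposite (τ x p) else τ x p

applyAllτ : ∀ {n} {S : MoveSeq n} → List (Move n) → PConfig S → PConfig S
applyAllτ []       τ = τ
applyAllτ (m ∷ ms) τ = applyAllτ ms (flipMoveτ m τ)

stateτ : ∀ {n} (S : MoveSeq n) → PConfig S → ℕ → PConfig S
stateτ S τ₀ k = applyAllτ (take k S) τ₀

Extends : ∀ {n} {S : MoveSeq n} → Config n → PConfig S → Set
Extends {n} {S} γ₀ τ₀ = (x : Fin n) (p : x ∈V S) → γ₀ x ≡ τ₀ x p

imprvEntry : ∀ {n} → Move n → Config n → Fin n → Fin n → ℤ
imprvEntry (single u) γ x y =
  if ⌊ x ≟ᶠ u ⌋ ∨ ⌊ y ≟ᶠ u ⌋ then sgn (γ x Sg.* γ y) else 0ℤ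
imprvEntry m@(pair u v _) γ x y =
  if (x ∈ᵇ m ∧ not (y ∈ᵇ m)) ∨ (y ∈ᵇ m ∧ not (x ∈ᵇ m))
  then sgn (γ x Sg.* γ y) else 0ℤ

-- imprv_{γ₀,S}(i), for 0-indexed i (paper's index i+1): uses γ_{i} (paper γ_{(i+1)-1})
imprvγ : ∀ {n} (S : MoveSeq n) → Config n → Fin (length S) → Fin n → Fin n → ℤ
imprvγ S γ₀ i x y = imprvEntry (lookup S i) (stateγ S γ₀ (toℕ i)) x y

imprvEntryτ : ∀ {n} {S : MoveSeq n} → Move n → PConfig S →
              (x y : Fin n) → x ∈V S → y ∈V S → ℤ
imprvEntryτ (single u) τ x y px py =
  if ⌊ x ≟ᶠ u ⌋ ∨ ⌊ y ≟ᶠ u ⌋ then sgn (τ x px Sg.* τ y py) else 0ℤ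
imprvEntryτ m@(pair u v _) τ x y px py =
  if (x ∈ᵇ m ∧ not (y ∈ᵇ m)) ∨ (y ∈ᵇ m ∧ not (x ∈ᵇ m))
  then sgn (τ x px Sg.* τ y py) else 0ℤ

imprvτ : ∀ {n} (S : MoveSeq n) → PConfig S → Fin (length S) →
         (x y : Fin n) → x ∈V S → y ∈V S → ℤ
imprvτ S τ₀ i x y px py = imprvEntryτ (lookup S i) (stateτ S τ₀ (toℕ i)) x y px py

Σℤ : ∀ {t} → (Fin t → ℤ) → ℤ
Σℤ {zero}  f = 0ℤ
Σℤ {suc t} f = f Fin.zero ℤ.+ Σℤ (λ j → f (Fin.suc j))

-- cycles.  Indices j ∈ [t] are Fin t; next j is j+1, and next (last) = first.

next : ∀ {m} → Fin (suc m) → Fin (suc m)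
next {m} i with toℕ i ℕ.≟ m
... | yes _ = Fin.zero
... | no ne = lower₁ (Fin.suc i) (λ eq → ne (sym (ℕ.suc-injective eq)))
  where import Data.Nat.Properties as ℕ

IsPairMove : ∀ {n} → Move n → Fin n → Fin n → Set
IsPairMove (single _)   x y = ⊥
IsPairMove (pair u v _) x y = ((u ≡ x) × (v ≡ y)) ⊎ ((u ≡ y) × (v ≡ x))

-- C = (c_1,...,c_t), t = 2 + k ≥ 2, is a cycle of S through nodes u_1,...,u_t:
-- distinct indices, S_{c_j} = {u_j, u_{j+1}}, S_{c_t} = {u_t, u_1}.
IsCycle : ∀ {n} (S : MoveSeq n) {k : ℕ} →
          (c : Fin (suc (suc k)) → Fin (length S)) → (u : Fin (suc (suc k)) → Fin n) → Set
IsCycle S {k} c u =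
  ((i j : Fin (suc (suc k))) → c i ≡ c j → i ≡ j) ×
  ((j : Fin (suc (suc k))) → IsPairMove (lookup S (c j)) (u j) (u (next j)))

-- b cancels along C w.r.t. τ₀:  b_j τ_{c_j}(u_{j+1}) + b_{j+1} τ_{c_{j+1}}(u_{j+1}) = 0
-- (indices cyclic), where τ_{c_j} is the configuration after move c_j
-- (paper's 1-indexed c_j = our toℕ (c j) + 1).
Cancels : ∀ {n} (S : MoveSeq n) {k : ℕ} →
          (c : Fin (suc (suc k)) → Fin (length S)) → (u : Fin (suc (suc k)) → Fin n) →
          (b : Fin (suc (suc k)) → Sign) → PConfig S → Set
Cancels S c u b τ₀ =
  ∀ j (p : u (next j) ∈V S) →
    sgn (b j) ℤ.* sgn (stateτ S τ₀ (suc (toℕ (c j))) (u (next j)) p)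
    ℤ.+ sgn (b (next j)) ℤ.* sgn (stateτ S τ₀ (suc (toℕ (c (next j)))) (u (next j)) p)
    ≡ 0ℤ

-- C is dependent with cancellation vector b (b_1 = 1): b cancels for some
-- τ₀ (the paper notes this does not depend on τ₀).
IsCancellationVector : ∀ {n} (S : MoveSeq n) {k : ℕ} →
          (c : Fin (suc (suc k)) → Fin (length S)) → (u : Fin (suc (suc k)) → Fin n) →
          (b : Fin (suc (suc k)) → Sign) → Set
IsCancellationVector S c u b =
  (b Fin.zero ≡ Sg.+) × Σ (PConfig S) (λ τ₀ → Cancels S c u b τ₀)

-- Every configuration evolves pointwise by multiplication with a sign that depends only on the
-- moves, so γ_k(v) and τ_k(v) differ by the factor γ₀(v)τ₀(v), independent of k.  On E(S) this
-- makes the two improvement vectors agree entrywise.  An edge {x, y} outside E(S) has an endpoint,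
-- say y, that never flips; the move c_j = {u_j, u_{j+1}} contributes b_j γ_{c_j - 1}(x) γ₀(y)
-- exactly when x ∈ {u_j, u_{j+1}}.  The contributions at x = v = u_{j+1} of c_j and c_{j+1}
-- cancel: v flips in both moves, so γ_{c - 1}(v) = -γ_c(v) = -γ₀(v)τ₀(v) τ_c(v) for c = c_j, c_{j+1}
-- and any τ₀ witnessing dependence, and the two contributions are the two terms of the
-- cancellation condition at v times the common sign -γ₀(v)τ₀(v)γ₀(y).

module Submission where

open import Defs
open import Data.Nat using (ℕ; suc)
open import Data.Fin using (Fin)
open import Data.List using (length)
open import Data.Sign using (Sign)
open import Data.Integer using (ℤ; _*_; 0ℤ)
open import Data.Product using (_×_)
open import Relation.Binary.PropositionalEquality using (_≡_; _≢_)
open import Relation.Nullary using (¬_)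

open import Data.Bool using (Bool; true; false; if_then_else_; _∨_; _∧_; not)
import Data.Bool.Properties as Boolₚ
open import Data.Fin using (zero; suc; toℕ; inject₁; fromℕ; _≟_)
import Data.Fin.Properties as Finₚ
open import Data.Integer using (_+_)
import Data.Integer.Properties as ℤₚ
open import Data.List using (List; []; _∷_; take; lookup)
open import Data.List.Membership.Propositional using (lose)
open import Data.List.Membership.Propositional.Properties using (∈-lookup)
open import Data.List.Relation.Unary.Any using (here; there; any?)
import Data.Nat as ℕ
import Data.Nat.Properties as ℕₚ
open import Data.Product using (_,_; proj₁; proj₂)
open import Data.Sign using (opposite) renaming (_*_ to _·_)
open import Data.Sign.Properties
  using (*-assoc; *-identityʳ; s*s≡+; opposite-involutive)
  renaming (*-comm to ·-comm)
open import Data.Sum using (inj₁; inj₂)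
open import Function using (_∘_)
open import Relation.Binary.PropositionalEquality
  using (refl; sym; trans; cong; cong₂; module ≡-Reasoning)
open import Relation.Nullary using (yes; no; contradiction)
open import Relation.Nullary.Decidable using (⌊_⌋)

open import Algebra.Properties.CommutativeMonoid.Sum ℤₚ.+-0-commutativeMonoid
  using (sum; sum-cong-≗; ∑-distrib-+; sum-replicate-zero; sum-init-last)

next-fromℕ : ∀ m → next (fromℕ m) ≡ zero
next-fromℕ m with toℕ (fromℕ m) ℕ.≟ m
... | yes _  = refl
... | no ≢m = contradiction (Finₚ.toℕ-fromℕ m) ≢m

next-inject₁ : ∀ {m} (j : Fin m) → next (inject₁ j) ≡ suc j
next-inject₁ {m} j with toℕ (inject₁ j) ℕ.≟ m
... | yes ≡m = contradiction (sym ≡m) (Finₚ.toℕ-inject₁-≢ j)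
... | no ≢m = Finₚ.toℕ-injective (trans
  (Finₚ.toℕ-lower₁ (suc (inject₁ j)) (λ eq → ≢m (sym (ℕₚ.suc-injective eq))))
  (cong suc (Finₚ.toℕ-inject₁ j)))

Σℤ≡sum : ∀ {t} (f : Fin t → ℤ) → Σℤ f ≡ sum f
Σℤ≡sum {ℕ.zero} f = refl
Σℤ≡sum {suc t}  f = cong (f zero +_) (Σℤ≡sum (f ∘ suc))

Σℤ-cong : ∀ {t} {f g : Fin t → ℤ} → (∀ j → f j ≡ g j) → Σℤ f ≡ Σℤ g
Σℤ-cong {f = f} {g} f≗g = trans (Σℤ≡sum f) (trans (sum-cong-≗ f≗g) (sym (Σℤ≡sum g)))

sum-next : ∀ {m} (f : Fin (suc m) → ℤ) → sum (f ∘ next) ≡ sum f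
sum-next {m} f = begin
  sum (f ∘ next)                                  ≡⟨ sum-init-last (f ∘ next) ⟩
  sum (f ∘ next ∘ inject₁) + f (next (fromℕ m))
    ≡⟨ cong₂ _+_ (sum-cong-≗ (cong f ∘ next-inject₁)) (cong f (next-fromℕ m)) ⟩
  sum (f ∘ suc) + f zero                          ≡⟨ ℤₚ.+-comm (sum (f ∘ suc)) (f zero) ⟩
  sum f                                           ∎
  where open ≡-Reasoning

sgn-· : ∀ s t → sgn (s · t) ≡ sgn s * sgn t
sgn-· s t = ℤₚ.◃-distrib-* s t 1 1

opposite-·ʳ : ∀ s t → opposite (s · t) ≡ s · opposite t
opposite-·ʳ Sign.+ t = refl
opposite-·ʳ Sign.- t = refl

SignsCancel : Sign → Sign → Sign → Sign → Set
SignsCancel b₁ a₁ b₂ a₂ = sgn b₁ * sgn a₁ + sgn b₂ * sgn a₂ ≡ 0ℤ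

SignsCancel-rescale : ∀ {b₁ a₁ b₂ a₂ a₁′ a₂′} σ → a₁′ ≡ a₁ · σ → a₂′ ≡ a₂ · σ →
                      SignsCancel b₁ a₁ b₂ a₂ → SignsCancel b₁ a₁′ b₂ a₂′
SignsCancel-rescale {b₁} {a₁} {b₂} {a₂} σ refl refl cancel = begin
  sgn b₁ * sgn (a₁ · σ) + sgn b₂ * sgn (a₂ · σ)
    ≡⟨ cong₂ _+_ (scaled b₁ a₁) (scaled b₂ a₂) ⟩
  sgn b₁ * sgn a₁ * sgn σ + sgn b₂ * sgn a₂ * sgn σ
    ≡⟨ ℤₚ.*-distribʳ-+ (sgn σ) (sgn b₁ * sgn a₁) (sgn b₂ * sgn a₂) ⟨
  (sgn b₁ * sgn a₁ + sgn b₂ * sgn a₂) * sgn σ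
    ≡⟨ cong (_* sgn σ) cancel ⟩
  0ℤ ∎
  where
  open ≡-Reasoning
  scaled : ∀ b a → sgn b * sgn (a · σ) ≡ sgn b * sgn a * sgn σ
  scaled b a = trans (cong (sgn b *_) (sgn-· a σ)) (sym (ℤₚ.*-assoc (sgn b) (sgn a) (sgn σ)))

flipSign : Bool → Sign
flipSign true  = Sign.-
flipSign false = Sign.+

flipIf≡flipSign· : ∀ c s → (if c then opposite s else s) ≡ flipSign c · s
flipIf≡flipSign· true  s = refl
flipIf≡flipSign· false s = refl

flips : ∀ {n} → List (Move n) → Fin n → Sign
flips []       x = Sign.+
flips (m ∷ ms) x = flips ms x · flipSign (x ∈ᵇ m)

applyAll≡flips· : ∀ {n} (ms : List (Move n)) γ x → applyAll ms γ x ≡ flips ms x · γ x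
applyAll≡flips· []       γ x = refl
applyAll≡flips· (m ∷ ms) γ x = trans (applyAll≡flips· ms (flipMove m γ) x)
  (trans (cong (flips ms x ·_) (flipIf≡flipSign· (x ∈ᵇ m) (γ x)))
         (sym (*-assoc (flips ms x) (flipSign (x ∈ᵇ m)) (γ x))))

applyAllτ≡flips· : ∀ {n} {S : MoveSeq n} (ms : List (Move n)) (τ : PConfig S) x p →
                   applyAllτ ms τ x p ≡ flips ms x · τ x p
applyAllτ≡flips· []       τ x p = refl
applyAllτ≡flips· (m ∷ ms) τ x p = trans (applyAllτ≡flips· ms (flipMoveτ m τ) x p)
  (trans (cong (flips ms x ·_) (flipIf≡flipSign· (x ∈ᵇ m) (τ x p)))
         (sym (*-assoc (flips ms x) (flipSign (x ∈ᵇ m)) (τ x p))))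

stateγ≡stateτ : ∀ {n} (S : MoveSeq n) {γ₀ τ₀} → Extends γ₀ τ₀ →
                ∀ k x p → stateγ S γ₀ k x ≡ stateτ S τ₀ k x p
stateγ≡stateτ S {γ₀} {τ₀} ext k x p = let ms = take k S in
  trans (applyAll≡flips· ms γ₀ x)
        (trans (cong (flips ms x ·_) (ext x p)) (sym (applyAllτ≡flips· ms τ₀ x p)))

stateγ≡stateτ·ratio : ∀ {n} (S : MoveSeq n) γ₀ (τ₀ : PConfig S) k x p →
                      stateγ S γ₀ k x ≡ stateτ S τ₀ k x p · (τ₀ x p · γ₀ x)
stateγ≡stateτ·ratio S γ₀ τ₀ k x p = begin
  stateγ S γ₀ k x                       ≡⟨ applyAll≡flips· (take k S) γ₀ x ⟩
  F · g                                 ≡⟨ cong (λ s → F · (s · g)) (s*s≡+ t) ⟨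
  F · ((t · t) · g)                     ≡⟨ cong (F ·_) (*-assoc t t g) ⟩
  F · (t · (t · g))                     ≡⟨ *-assoc F t (t · g) ⟨
  (F · t) · (t · g)                     ≡⟨ cong (_· (t · g)) (applyAllτ≡flips· (take k S) τ₀ x p) ⟨
  stateτ S τ₀ k x p · (t · g)           ∎
  where
  open ≡-Reasoning
  F = flips (take k S) x
  t = τ₀ x p
  g = γ₀ x

flips-∉V : ∀ {n} (S : MoveSeq n) k x → ¬ x ∈V S → flips (take k S) x ≡ Sign.+
flips-∉V []      ℕ.zero  x x∉ = refl
flips-∉V []      (suc k) x x∉ = refl
flips-∉V (m ∷ S) ℕ.zero  x x∉ = refl
flips-∉V (m ∷ S) (suc k) x x∉ with x ∈ᵇ m in x∈m
... | true  = contradiction (here x∈m) x∉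
... | false = trans (*-identityʳ _) (flips-∉V S k x (x∉ ∘ there))

stateγ-∉V : ∀ {n} (S : MoveSeq n) γ₀ k x → ¬ x ∈V S → stateγ S γ₀ k x ≡ γ₀ x
stateγ-∉V S γ₀ k x x∉ =
  trans (applyAll≡flips· (take k S) γ₀ x) (cong (_· γ₀ x) (flips-∉V S k x x∉))

stateγ-suc : ∀ {n} (S : MoveSeq n) γ₀ (i : Fin (length S)) x →
             stateγ S γ₀ (suc (toℕ i)) x ≡ flipMove (lookup S i) (stateγ S γ₀ (toℕ i)) x
stateγ-suc (m ∷ S) γ₀ zero    x = refl
stateγ-suc (m ∷ S) γ₀ (suc i) x = stateγ-suc S (flipMove m γ₀) i x

stateγ-before-flip : ∀ {n} (S : MoveSeq n) γ₀ (i : Fin (length S)) x → x ∈ᵇ lookup S i ≡ true →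
                     stateγ S γ₀ (toℕ i) x ≡ opposite (stateγ S γ₀ (suc (toℕ i)) x)
stateγ-before-flip S γ₀ i x x∈ = begin
  stateγ S γ₀ (toℕ i) x                   ≡⟨ opposite-involutive γᵢx ⟨
  opposite (opposite γᵢx)
    ≡⟨ cong (λ e → opposite (if e then opposite γᵢx else γᵢx)) x∈ ⟨
  opposite (flipMove (lookup S i) (stateγ S γ₀ (toℕ i)) x)
    ≡⟨ cong opposite (stateγ-suc S γ₀ i x) ⟨
  opposite (stateγ S γ₀ (suc (toℕ i)) x)  ∎
  where
  open ≡-Reasoning
  γᵢx = stateγ S γ₀ (toℕ i) x

∈ᵇ-lookup⇒∈V : ∀ {n} (S : MoveSeq n) i x → x ∈ᵇ lookup S i ≡ true → x ∈V S
∈ᵇ-lookup⇒∈V S i x = lose (∈-lookup i)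

∉V⇒∉ᵇ-lookup : ∀ {n} (S : MoveSeq n) i x → ¬ x ∈V S → x ∈ᵇ lookup S i ≡ false
∉V⇒∉ᵇ-lookup S i x x∉ with x ∈ᵇ lookup S i in x∈
... | true  = contradiction (∈ᵇ-lookup⇒∈V S i x x∈) x∉
... | false = refl

IsPairMove⇒≢ : ∀ {n} (m : Move n) {a c} → IsPairMove m a c → a ≢ c
IsPairMove⇒≢ (pair u v u≢v) (inj₁ (refl , refl)) = u≢v
IsPairMove⇒≢ (pair u v u≢v) (inj₂ (refl , refl)) = u≢v ∘ sym

IsPairMove⇒∈ᵇ : ∀ {n} (m : Move n) {a c} → IsPairMove m a c → ∀ x →
                x ∈ᵇ m ≡ ⌊ x ≟ a ⌋ ∨ ⌊ x ≟ c ⌋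
IsPairMove⇒∈ᵇ (pair u v _) (inj₁ (refl , refl)) x = refl
IsPairMove⇒∈ᵇ (pair u v _) (inj₂ (refl , refl)) x = Boolₚ.∨-comm ⌊ x ≟ u ⌋ ⌊ x ≟ v ⌋

⌊≟⌋-refl : ∀ {n} (x : Fin n) → ⌊ x ≟ x ⌋ ≡ true
⌊≟⌋-refl x with x ≟ x
... | yes _   = refl
... | no x≢x = contradiction refl x≢x

IsPairMove⇒∈ᵇˡ : ∀ {n} (m : Move n) {a c} → IsPairMove m a c → a ∈ᵇ m ≡ true
IsPairMove⇒∈ᵇˡ m {a} {c} pm = trans (IsPairMove⇒∈ᵇ m pm a) (cong (_∨ ⌊ a ≟ c ⌋) (⌊≟⌋-refl a))

IsPairMove⇒∈ᵇʳ : ∀ {n} (m : Move n) {a c} → IsPairMove m a c → c ∈ᵇ m ≡ true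
IsPairMove⇒∈ᵇʳ m {a} {c} pm = trans (IsPairMove⇒∈ᵇ m pm c)
  (trans (cong (⌊ c ≟ a ⌋ ∨_) (⌊≟⌋-refl c)) (Boolₚ.∨-zeroʳ ⌊ c ≟ a ⌋))

imprvEntry≡imprvEntryτ : ∀ {n} {S : MoveSeq n} m γ (τ : PConfig S) x y px py →
                         γ x ≡ τ x px → γ y ≡ τ y py →
                         imprvEntry m γ x y ≡ imprvEntryτ m τ x y px py
imprvEntry≡imprvEntryτ (single u)   γ τ x y px py γx≡ γy≡ rewrite γx≡ | γy≡ = refl
imprvEntry≡imprvEntryτ (pair u v _) γ τ x y px py γx≡ γy≡ rewrite γx≡ | γy≡ = refl

imprvEntry-sym : ∀ {n} (m : Move n) γ x y → imprvEntry m γ x y ≡ imprvEntry m γ y x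
imprvEntry-sym (single u) γ x y = cong₂ (λ c w → if c then w else 0ℤ)
  (Boolₚ.∨-comm ⌊ x ≟ u ⌋ ⌊ y ≟ u ⌋) (cong sgn (·-comm (γ x) (γ y)))
imprvEntry-sym m@(pair u v _) γ x y = cong₂ (λ c w → if c then w else 0ℤ)
  (Boolₚ.∨-comm (x ∈ᵇ m ∧ not (y ∈ᵇ m)) _) (cong sgn (·-comm (γ x) (γ y)))

imprvEntry-pair-∉ : ∀ {n} (m : Move n) {a c} → IsPairMove m a c → ∀ γ x y → y ∈ᵇ m ≡ false →
                    imprvEntry m γ x y ≡ (if x ∈ᵇ m then sgn (γ x · γ y) else 0ℤ)
imprvEntry-pair-∉ m@(pair u v _) _ γ x y y∉ rewrite y∉ =
  cong (λ c → if c then sgn (γ x · γ y) else 0ℤ)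
    (trans (Boolₚ.∨-identityʳ (x ∈ᵇ m ∧ true)) (Boolₚ.∧-identityʳ (x ∈ᵇ m)))

*-if-∨-split : ∀ {n} {a c : Fin n} (x : Fin n) (s w : ℤ) → a ≢ c →
  s * (if ⌊ x ≟ a ⌋ ∨ ⌊ x ≟ c ⌋ then w else 0ℤ)
    ≡ (if ⌊ x ≟ c ⌋ then s * w else 0ℤ) + (if ⌊ x ≟ a ⌋ then s * w else 0ℤ)
*-if-∨-split {a = a} {c} x s w a≢c with x ≟ a | x ≟ c
... | yes refl | yes refl = contradiction refl a≢c
... | yes _    | no _     = sym (ℤₚ.+-identityˡ (s * w))
... | no _     | yes _    = sym (ℤₚ.+-identityʳ (s * w))
... | no _     | no _     = ℤₚ.*-zeroʳ s

module DependentCycle {n} (S : MoveSeq n) {k : ℕ}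
    (c : Fin (suc (suc k)) → Fin (length S)) (u : Fin (suc (suc k)) → Fin n)
    (b : Fin (suc (suc k)) → Sign)
    (cycle : IsCycle S c u) (dependent : IsCancellationVector S c u b) (γ₀ : Config n) where

  γ : Fin (suc (suc k)) → Config n
  γ j = stateγ S γ₀ (toℕ (c j))

  cancels-at-successor : ∀ j Y →
    SignsCancel (b j) (γ j (u (next j)) · Y) (b (next j)) (γ (next j) (u (next j)) · Y)
  cancels-at-successor j Y =
    SignsCancel-rescale {b j} {after j} {b (next j)} {after (next j)} σ
      (before-move j v∈c) (before-move (next j) v∈c′) (cancels j p)
    where
    v = u (next j)
    τ₀ = proj₁ (proj₂ dependent)
    cancels = proj₂ (proj₂ dependent)
    v∈c : v ∈ᵇ lookup S (c j) ≡ true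
    v∈c = IsPairMove⇒∈ᵇʳ (lookup S (c j)) (proj₂ cycle j)
    v∈c′ : v ∈ᵇ lookup S (c (next j)) ≡ true
    v∈c′ = IsPairMove⇒∈ᵇˡ (lookup S (c (next j))) (proj₂ cycle (next j))
    p : v ∈V S
    p = ∈ᵇ-lookup⇒∈V S (c j) v v∈c
    σ = opposite (τ₀ v p · γ₀ v) · Y
    after : Fin (suc (suc k)) → Sign
    after i = stateτ S τ₀ (suc (toℕ (c i))) v p
    before-move : ∀ i → v ∈ᵇ lookup S (c i) ≡ true → γ i v · Y ≡ after i · σ
    before-move i v∈ = begin
      γ i v · Y
        ≡⟨ cong (_· Y) (stateγ-before-flip S γ₀ (c i) v v∈) ⟩
      opposite (stateγ S γ₀ k′ v) · Y
        ≡⟨ cong (λ s → opposite s · Y) (stateγ≡stateτ·ratio S γ₀ τ₀ k′ v p) ⟩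
      opposite (τ′ · ρ) · Y
        ≡⟨ cong (_· Y) (opposite-·ʳ τ′ ρ) ⟩
      τ′ · opposite ρ · Y
        ≡⟨ *-assoc τ′ (opposite ρ) Y ⟩
      τ′ · σ ∎
      where
      open ≡-Reasoning
      k′ = suc (toℕ (c i))
      τ′ = stateτ S τ₀ k′ v p
      ρ = τ₀ v p · γ₀ v

  weighted-sum-∉V : ∀ x y → ¬ y ∈V S →
                    Σℤ (λ j → sgn (b j) * imprvγ S γ₀ (c j) x y) ≡ 0ℤ
  weighted-sum-∉V x y y∉ = begin
    Σℤ (λ j → sgn (b j) * imprvγ S γ₀ (c j) x y)
      ≡⟨ Σℤ≡sum (λ j → sgn (b j) * imprvγ S γ₀ (c j) x y) ⟩
    sum (λ j → sgn (b j) * imprvγ S γ₀ (c j) x y)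
      ≡⟨ sum-cong-≗ split ⟩
    sum (λ j → T j (u (next j)) + T j (u j))
      ≡⟨ ∑-distrib-+ (λ j → T j (u (next j))) (λ j → T j (u j)) ⟩
    sum (λ j → T j (u (next j))) + sum (λ j → T j (u j))
      ≡⟨ cong (sum (λ j → T j (u (next j))) +_) (sum-next (λ j → T j (u j))) ⟨
    sum (λ j → T j (u (next j))) + sum (λ j → T (next j) (u (next j)))
      ≡⟨ ∑-distrib-+ (λ j → T j (u (next j))) (λ j → T (next j) (u (next j))) ⟨
    sum (λ j → T j (u (next j)) + T (next j) (u (next j)))
      ≡⟨ sum-cong-≗ pair-cancels ⟩
    sum {suc (suc k)} (λ _ → 0ℤ)
      ≡⟨ sum-replicate-zero (suc (suc k)) ⟩
    0ℤ ∎
    where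
    open ≡-Reasoning
    w : Fin (suc (suc k)) → ℤ
    w j = sgn (b j) * sgn (γ j x · γ₀ y)
    T : Fin (suc (suc k)) → Fin n → ℤ
    T j a = if ⌊ x ≟ a ⌋ then w j else 0ℤ
    split : ∀ j → sgn (b j) * imprvγ S γ₀ (c j) x y ≡ T j (u (next j)) + T j (u j)
    split j = let m = lookup S (c j) ; pm = proj₂ cycle j in begin
      sgn (b j) * imprvEntry m (γ j) x y
        ≡⟨ cong (sgn (b j) *_) (imprvEntry-pair-∉ m pm (γ j) x y (∉V⇒∉ᵇ-lookup S (c j) y y∉)) ⟩
      sgn (b j) * (if x ∈ᵇ m then sgn (γ j x · γ j y) else 0ℤ)
        ≡⟨ cong₂ (λ e t → sgn (b j) * (if e then sgn (γ j x · t) else 0ℤ))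
                 (IsPairMove⇒∈ᵇ m pm x) (stateγ-∉V S γ₀ (toℕ (c j)) y y∉) ⟩
      sgn (b j) * (if ⌊ x ≟ u j ⌋ ∨ ⌊ x ≟ u (next j) ⌋ then sgn (γ j x · γ₀ y) else 0ℤ)
        ≡⟨ *-if-∨-split x (sgn (b j)) _ (IsPairMove⇒≢ m pm) ⟩
      T j (u (next j)) + T j (u j) ∎
    pair-cancels : ∀ j → T j (u (next j)) + T (next j) (u (next j)) ≡ 0ℤ
    pair-cancels j with x ≟ u (next j)
    ... | yes refl = cancels-at-successor j (γ₀ y)
    ... | no _     = refl

lemma2p7 : ∀ {n} (S : MoveSeq n) {k : ℕ}
    (c : Fin (suc (suc k)) → Fin (length S)) (u : Fin (suc (suc k)) → Fin n)
    (b : Fin (suc (suc k)) → Sign) →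
    IsCycle S c u → IsCancellationVector S c u b →
    (τ₀ : PConfig S) (γ₀ : Config n) → Extends γ₀ τ₀ →
    ((x y : Fin n) (xy : x ≢ y) (px : x ∈V S) (py : y ∈V S) →
       Σℤ (λ j → sgn (b j) * imprvγ S γ₀ (c j) x y)
         ≡ Σℤ (λ j → sgn (b j) * imprvτ S τ₀ (c j) x y px py))
    × ((x y : Fin n) → x ≢ y → ¬ (x ∈V S × y ∈V S) →
       Σℤ (λ j → sgn (b j) * imprvγ S γ₀ (c j) x y) ≡ 0ℤ)
lemma2p7 {n} S c u b cycle dependent τ₀ γ₀ ext = inside , outside
  where
  open DependentCycle S c u b cycle dependent γ₀
  inside : (x y : Fin n) → x ≢ y → (px : x ∈V S) (py : y ∈V S) →
           Σℤ (λ j → sgn (b j) * imprvγ S γ₀ (c j) x y)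
             ≡ Σℤ (λ j → sgn (b j) * imprvτ S τ₀ (c j) x y px py)
  inside x y _ px py = Σℤ-cong λ j → cong (sgn (b j) *_)
    (imprvEntry≡imprvEntryτ (lookup S (c j)) (γ j) (stateτ S τ₀ (toℕ (c j))) x y px py
      (stateγ≡stateτ S ext (toℕ (c j)) x px) (stateγ≡stateτ S ext (toℕ (c j)) y py))
  outside : (x y : Fin n) → x ≢ y → ¬ (x ∈V S × y ∈V S) →
            Σℤ (λ j → sgn (b j) * imprvγ S γ₀ (c j) x y) ≡ 0ℤ
  outside x y _ ¬both with any? (λ m → y ∈ᵇ m Boolₚ.≟ true) S
  ... | no y∉  = weighted-sum-∉V x y y∉
  ... | yes y∈ = trans
    (Σℤ-cong λ j → cong (sgn (b j) *_) (imprvEntry-sym (lookup S (c j)) (γ j) x y))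
    (weighted-sum-∉V y x (λ x∈ → ¬both (x∈ , y∈)))
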